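{- Let $T$ be a tree of order $n\ge 5$. Then $vcfc(T)\le\lceil n/2\rceil$. Moreover, the bound is sharp: for $T=P_5$ (the path on $5$ vertices), $vcfc(T)=3=\lceil 5/2\rceil$.
   Context: Vertex-colorings are arbitrary, not necessarily proper. A path in a vertex-colored graph is called conflict-free if there is a color used on exactly one of its vertices. A vertex-colored graph is conflict-free vertex-connected if any two vertices of the graph are connected by a conflict-free path. For a connected graph $G$, the conflict-free vertex-connection number $vcfc(G)$ is the smallest number of colors needed in a vertex-coloring of $G$ that makes $G$ conflict-free vertex-connected. -}

module Defs where

open import Level using (0ℓ)
open import Data.Nat using (ℕ; suc; _≤_; _≥_)
open import Data.Fin as Fin using (Fin; toℕ)
open import Data.List using (List; []; _∷_; length; filter)
open import Data.List.Relation.Unary.Unique.Propositional using (Unique)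
open import Data.Product using (Σ; ∃; _×_)
open import Data.Sum using (_⊎_)
open import Data.Empty using (⊥)
open import Relation.Nullary using (¬_)
open import Relation.Binary.PropositionalEquality using (_≡_)

record Graph (n : ℕ) : Set₁ where
  field
    Adj     : Fin n → Fin n → Set
    sym     : ∀ {u v} → Adj u v → Adj v u
    irrefl  : ∀ {u} → ¬ Adj u u
open Graph public

module _ {n : ℕ} (G : Graph n) where

  data Walk : Fin n → Fin n → List (Fin n) → Set where
    single : ∀ {u} → Walk u u (u ∷ [])
    step   : ∀ {u w v xs} → Adj G u w → Walk w v xs → Walk u v (u ∷ xs)

  IsPath : Fin n → Fin n → List (Fin n) → Set
  IsPath u v xs = Walk u v xs × Unique xs

  Connected : Set
  Connected = ∀ u v → ∃ λ xs → IsPath u v xs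

  IsCycle : List (Fin n) → Set
  IsCycle xs = Σ (Fin n) λ x → Σ (Fin n) λ y →
    IsPath x y xs × Adj G y x × 3 ≤ length xs

  Acyclic : Set
  Acyclic = ∀ xs → ¬ IsCycle xs

  IsTree : Set
  IsTree = Connected × Acyclic

  -- Arbitrary (not necessarily proper) vertex colouring with k colours.
  Coloring : ℕ → Set
  Coloring k = Fin n → Fin k

  countColor : ∀ {k} → Coloring k → Fin k → List (Fin n) → ℕ
  countColor col c xs = length (filter (λ x → col x Fin.≟ c) xs)

  ConflictFree : ∀ {k} → Coloring k → List (Fin n) → Set
  ConflictFree {k} col xs = Σ (Fin k) λ c → countColor col c xs ≡ 1

  CFVConnected : ∀ {k} → Coloring k → Set
  CFVConnected col = ∀ u v → ∃ λ xs → IsPath u v xs × ConflictFree col xs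

  HasCFVColoring : ℕ → Set
  HasCFVColoring k = Σ (Coloring k) CFVConnected

  IsVcfc : ℕ → Set
  IsVcfc k = HasCFVColoring k × (∀ j → HasCFVColoring j → k ≤ j)

pathGraph : (n : ℕ) → Graph n
pathGraph n = record
  { Adj = λ i j → toℕ j ≡ suc (toℕ i) ⊎ toℕ i ≡ suc (toℕ j)
  ; sym = λ { (Data.Sum.inj₁ p) → Data.Sum.inj₂ p ; (Data.Sum.inj₂ p) → Data.Sum.inj₁ p }
  ; irrefl = irr
  }
  where
  open import Data.Nat.Properties using (1+n≢n)
  open import Relation.Binary.PropositionalEquality using () renaming (sym to sym≡)
  irr : ∀ {u} → ¬ (toℕ u ≡ suc (toℕ u) ⊎ toℕ u ≡ suc (toℕ u))
  irr (Data.Sum.inj₁ p) = 1+n≢n (sym≡ p)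
  irr (Data.Sum.inj₂ p) = 1+n≢n (sym≡ p)

-- Root the tree at a leaf r and split the vertices by the parity of their depth. Adjacent
-- vertices have different parity, so every path with an edge meets both classes: giving one
-- class pairwise distinct colours and the other class one shared colour makes every path
-- conflict-free, and this costs at most ⌈n/2⌉ colours when the even class is the smaller one.
-- Otherwise the odd class, which contains r, has at most ⌈n/2⌉ vertices. If some vertex t lies
-- at distance 4 from r, then r may reuse the colour of t while the even class takes the colour
-- freed by r: a path through both r and t passes through distance 2, whose vertex keeps a
-- unique colour. If no vertex is that far, the tree is shallow enough for three colours,
-- layer by layer. For P₅ the lower bound is a finite check, decidable because paths in
-- trees are unique.
module Submission where

open import Defs
open import Data.Nat using (ℕ; zero; suc; _≤_; _≥_; _<_; _+_; _∸_; z≤n; s≤s; _≤?_; ⌈_/2⌉; ⌊_/2⌋)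
import Data.Nat as ℕ
open import Data.Nat.Properties
  using ( ≤-refl; ≤-reflexive; ≤-trans; ≤-antisym; ≤-pred; ≤-total; <⇒≤; <⇒≱; <⇒≢; ≰⇒>; ≮⇒≥; <-cmp
        ; n≤1+n; 1+n≰n; m≤n⇒m≤1+n; m≤m+n; m≤n+m; suc-injective
        ; +-comm; +-suc; +-identityʳ; +-mono-≤; +-monoˡ-≤; +-cancelʳ-≤; +-cancelʳ-≡; m+[n∸m]≡n
        ; ⌊n/2⌋+⌈n/2⌉≡n; ⌊n/2⌋≤⌈n/2⌉; ⌈n/2⌉-mono; anyUpTo? )
open import Data.Nat.Induction using (<-rec)
open import Data.Fin as Fin using (Fin; toℕ; fromℕ<; #_; _≟_)
open import Data.Fin.Properties
  using (toℕ-injective; toℕ-fromℕ<; toℕ<n) renaming (any? to Fin-any?; all? to Fin-all?)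
import Data.Vec.Functional as Vector
open import Data.Vec using (lookup; []; _∷_)
open import Data.Bool using (Bool; true; false; not; if_then_else_)
open import Data.Bool.Properties using (not-involutive)
open import Data.List using (List; []; _∷_; _++_; _∷ʳ_; reverse; length; allFin)
open import Data.List.Properties
  using ( length-++; length-reverse; ++-assoc; ++-identityʳ; ++-identityʳ-unique; ++-conicalˡ
        ; unfold-reverse; reverse-++; ∷ʳ-injectiveˡ )
open import Data.List.Extrema.Nat using (argmax; f[xs]≤f[argmax])
open import Data.List.Relation.Unary.All as All using (All; []; _∷_)
open import Data.List.Relation.Unary.All.Properties using (¬Any⇒All¬)
open import Data.List.Relation.Unary.AllPairs using ([]; _∷_)
open import Data.List.Relation.Unary.Any using (here; there; any?)
open import Data.List.Relation.Unary.Any.Properties using (reverse⁻)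
open import Data.List.Relation.Unary.Unique.Propositional using (Unique)
open import Data.List.Relation.Unary.Unique.Propositional.Properties using (++⁺; Unique[x∷xs]⇒x∉xs)
open import Data.List.Membership.Propositional using (_∈_; _∉_; find; lose)
open import Data.List.Membership.Propositional.Properties using (∈-++⁺ˡ; ∈-++⁻; ∈-allFin)
import Data.List.Relation.Binary.Permutation.Setoid as Permutation
import Data.List.Relation.Binary.Permutation.Setoid.Properties as Permutation
open import Data.Product using (∃; ∃₂; _×_; _,_; proj₁; proj₂; map₁; map₂)
open import Data.Sum using (_⊎_; inj₁; inj₂; [_,_]′)
open import Data.Empty using (⊥-elim)
open import Function using (_∘_; case_of_)
open import Relation.Nullary using (¬_; Dec; yes; no; does)
open import Relation.Nullary.Decidable using (map′; toWitness; toWitnessFalse)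
open import Relation.Binary.Definitions using (tri<; tri≈; tri>)
open import Relation.Binary.PropositionalEquality as ≡ using (_≡_; _≢_; _≗_; refl; cong; subst; setoid)

module _ {A : Set} where

  Unique-reverse : ∀ {xs : List A} → Unique xs → Unique (reverse xs)
  Unique-reverse {xs} =
    Permutation.Unique-resp-↭ (setoid A) (Permutation.↭-sym (setoid A) (Permutation.↭-reverse (setoid A) xs))

  ∈-reverse⁻ : ∀ {x : A} xs → x ∈ reverse xs → x ∈ xs
  ∈-reverse⁻ _ = reverse⁻

  length-∷ʳ : ∀ (xs : List A) {x} → length (xs ∷ʳ x) ≡ suc (length xs)
  length-∷ʳ []       = refl
  length-∷ʳ (_ ∷ xs) = cong suc (length-∷ʳ xs)

  Unique-++⁻ˡ : ∀ (xs : List A) {ys} → Unique (xs ++ ys) → Unique xs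
  Unique-++⁻ˡ []       _          = []
  Unique-++⁻ˡ (x ∷ xs) (x∉ ∷ u) = All.tabulate (λ m → All.lookup x∉ (∈-++⁺ˡ m)) ∷ Unique-++⁻ˡ xs u

module Walks {n : ℕ} (G : Graph n) where

  walk-source∈ : ∀ {a b s} → Walk G a b s → a ∈ s
  walk-source∈ single     = here refl
  walk-source∈ (step _ _) = here refl

  walk-target∈ : ∀ {a b s} → Walk G a b s → b ∈ s
  walk-target∈ single     = here refl
  walk-target∈ (step _ p) = there (walk-target∈ p)

  walk-target-unique : ∀ {a a′ b b′ s} → Walk G a b s → Walk G a′ b′ s → b ≡ b′
  walk-target-unique single      single      = refl
  walk-target-unique single      (step _ ())
  walk-target-unique (step _ ()) single
  walk-target-unique (step _ p)  (step _ p′) = walk-target-unique p p′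

  walk-length≥1 : ∀ {a b s} → Walk G a b s → 1 ≤ length s
  walk-length≥1 single     = s≤s z≤n
  walk-length≥1 (step _ _) = s≤s z≤n

  walk-length≥2 : ∀ {a b s} → Walk G a b s → a ≢ b → 2 ≤ length s
  walk-length≥2 single     a≢b = ⊥-elim (a≢b refl)
  walk-length≥2 (step _ p) _   = s≤s (walk-length≥1 p)

  walk-length≡1 : ∀ {a b s} → Walk G a b s → length s ≡ 1 → a ≡ b
  walk-length≡1 single              _ = refl
  walk-length≡1 (step _ single)     ()
  walk-length≡1 (step _ (step _ _)) ()

  walk-length≡2 : ∀ {a b s} → Walk G a b s → length s ≡ 2 → Adj G a b
  walk-length≡2 (step e p) eq with walk-length≡1 p (suc-injective eq)
  ... | refl = e

  walk-∷ʳ : ∀ {a b c s} → Walk G a b s → Adj G b c → Walk G a c (s ∷ʳ c)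
  walk-∷ʳ single      e = step e single
  walk-∷ʳ (step e′ p) e = step e′ (walk-∷ʳ p e)

  walk-reverse : ∀ {a b s} → Walk G a b s → Walk G b a (reverse s)
  walk-reverse single                 = single
  walk-reverse {s = a ∷ s} (step e p) =
    subst (Walk G _ _) (≡.sym (unfold-reverse a s)) (walk-∷ʳ (walk-reverse p) (sym G e))

  walk-++ : ∀ {a b c s t} → Walk G a b s → Walk G b c (b ∷ t) → Walk G a c (s ++ t)
  walk-++ single     p′ = p′
  walk-++ (step e p) p′ = step e (walk-++ p p′)

  walk-prefix : ∀ {a b s z} → Walk G a b s → z ∈ s →
                ∃₂ λ pre rest → s ≡ pre ++ rest × Walk G a z pre
  walk-prefix single     (here refl) = _ , [] , refl , single
  walk-prefix (step e p) (here refl) = _ , _ , refl , single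
  walk-prefix (step e p) (there z∈) with walk-prefix p z∈
  ... | pre , rest , refl , p′ = _ ∷ pre , rest , refl , step e p′

  walk-first-hit : ∀ {a b s} ys → Walk G a b s → b ∈ ys →
                   ∃ λ z → ∃₂ λ pre rest →
                     s ≡ pre ++ z ∷ rest × All (_∉ ys) pre × z ∈ ys × Walk G a z (pre ∷ʳ z)
  walk-first-hit {a} ys p b∈ys with any? (a ≟_) ys
  walk-first-hit ys single     _    | yes a∈ys = _ , [] , [] , refl , [] , a∈ys , single
  walk-first-hit ys (step _ _) _    | yes a∈ys = _ , [] , _ , refl , [] , a∈ys , single
  walk-first-hit ys single     b∈ys | no a∉ys  = ⊥-elim (a∉ys b∈ys)
  walk-first-hit ys (step e p) b∈ys | no a∉ys with walk-first-hit ys p b∈ys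
  ... | z , pre , rest , refl , pre∉ys , z∈ys , p′ =
    z , _ ∷ pre , rest , refl , a∉ys ∷ pre∉ys , z∈ys , step e p′

  cycle-length : ∀ {w₁ w₂ z pre₂} pre → Walk G w₁ z (pre ∷ʳ z) → Walk G w₂ z pre₂ → w₁ ≢ w₂ →
                 2 ≤ length (pre₂ ++ reverse pre)
  cycle-length {pre₂ = pre₂} [] single p₂ w₁≢w₂ =
    subst (2 ≤_) (cong length (≡.sym (++-identityʳ pre₂))) (walk-length≥2 p₂ (w₁≢w₂ ∘ ≡.sym))
  cycle-length {pre₂ = pre₂} (x ∷ pre) _ p₂ _ =
    subst (2 ≤_) (≡.sym (≡.trans (length-++ pre₂) (cong (length pre₂ +_) (length-reverse (x ∷ pre)))))
      (+-mono-≤ (walk-length≥1 p₂) (s≤s z≤n))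

  -- Follow the first path until it meets the second one; the two pieces close a cycle through a.
  diverging-paths-cycle : ∀ {a w₁ w₂ b xs ys} →
    Adj G a w₁ → Walk G w₁ b xs → Unique (a ∷ xs) →
    Adj G a w₂ → Walk G w₂ b ys → Unique (a ∷ ys) → w₁ ≢ w₂ → ∃ (IsCycle G)
  diverging-paths-cycle {a} {w₁} {ys = ys} e₁ p₁ u₁@(_ ∷ xs-unique) e₂ p₂ u₂@(_ ∷ ys-unique) w₁≢w₂
    with walk-first-hit ys p₁ (walk-target∈ p₂)
  ... | z , pre , rest , refl , pre∉ys , z∈ys , p₁′ with walk-prefix p₂ z∈ys
  ... | pre₂ , rest₂ , refl , p₂′ =
    a ∷ pre₂ ++ reverse pre , a , w₁ , (step e₂ (walk-++ p₂′ back) , unique) , sym G e₁ ,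
    s≤s (cycle-length pre p₁′ p₂′ w₁≢w₂)
    where
    back : Walk G z w₁ (z ∷ reverse pre)
    back = subst (Walk G z w₁) (reverse-++ pre (z ∷ [])) (walk-reverse p₁′)
    a∉ : a ∉ pre₂ ++ reverse pre
    a∉ m = [ Unique[x∷xs]⇒x∉xs u₂ ∘ ∈-++⁺ˡ , Unique[x∷xs]⇒x∉xs u₁ ∘ ∈-++⁺ˡ ∘ ∈-reverse⁻ pre ]′
             (∈-++⁻ pre₂ m)
    unique : Unique (a ∷ pre₂ ++ reverse pre)
    unique = ¬Any⇒All¬ _ a∉
           ∷ ++⁺ (Unique-++⁻ˡ pre₂ ys-unique) (Unique-reverse (Unique-++⁻ˡ pre xs-unique))
                 (λ (m₂ , m) → All.lookup pre∉ys (∈-reverse⁻ pre m) (∈-++⁺ˡ m₂))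

  module _ (acyclic : Acyclic G) where

    path-unique : ∀ {a b s t} → Walk G a b s → Unique s → Walk G a b t → Unique t → s ≡ t
    path-unique single     _ single     _ = refl
    path-unique single     _ (step _ p) u = ⊥-elim (Unique[x∷xs]⇒x∉xs u (walk-target∈ p))
    path-unique (step _ p) u single     _ = ⊥-elim (Unique[x∷xs]⇒x∉xs u (walk-target∈ p))
    path-unique (step {w = w₁} e₁ p₁) u₁@(_ ∷ s-unique) (step {w = w₂} e₂ p₂) u₂@(_ ∷ t-unique)
      with w₁ ≟ w₂
    ... | yes refl = cong (_ ∷_) (path-unique p₁ s-unique p₂ t-unique)
    ... | no w₁≢w₂ = ⊥-elim (let cycle , isCycle = diverging-paths-cycle e₁ p₁ u₁ e₂ p₂ u₂ w₁≢w₂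
                             in acyclic cycle isCycle)

count : ∀ {m} → (Fin m → Bool) → ℕ
count {zero}  S = 0
count {suc m} S = if S Fin.zero then suc (count (S ∘ Fin.suc)) else count (S ∘ Fin.suc)

rank : ∀ {m} → (Fin m → Bool) → Fin m → ℕ
rank S Fin.zero    = 0
rank S (Fin.suc v) = if S Fin.zero then suc (rank (S ∘ Fin.suc) v) else rank (S ∘ Fin.suc) v

rank<count : ∀ {m} (S : Fin m → Bool) {v} → S v ≡ true → rank S v < count S
rank<count S {Fin.zero} Sv rewrite Sv = s≤s z≤n
rank<count S {Fin.suc v} Sv with S Fin.zero
... | true  = s≤s (rank<count (S ∘ Fin.suc) Sv)
... | false = rank<count (S ∘ Fin.suc) Sv

rank-injective : ∀ {m} (S : Fin m → Bool) {u v} → S u ≡ true → S v ≡ true → rank S u ≡ rank S v → u ≡ v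
rank-injective S {Fin.zero}  {Fin.zero}  _  _  _ = refl
rank-injective S {Fin.zero}  {Fin.suc _} Su _  eq rewrite Su with eq
... | ()
rank-injective S {Fin.suc _} {Fin.zero}  _  Sv eq rewrite Sv with eq
... | ()
rank-injective S {Fin.suc u} {Fin.suc v} Su Sv eq with S Fin.zero
... | true  = cong Fin.suc (rank-injective (S ∘ Fin.suc) Su Sv (suc-injective eq))
... | false = cong Fin.suc (rank-injective (S ∘ Fin.suc) Su Sv eq)

count+count-not : ∀ {m} (S : Fin m → Bool) → count S + count (not ∘ S) ≡ m
count+count-not {zero}  S = refl
count+count-not {suc m} S with S Fin.zero
... | true  = cong suc (count+count-not (S ∘ Fin.suc))
... | false = ≡.trans (+-suc (count (S ∘ Fin.suc)) _) (cong suc (count+count-not (S ∘ Fin.suc)))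

odd : ℕ → Bool
odd zero    = false
odd (suc k) = not (odd k)

complement<half : ∀ {a b n} → a + b ≡ n → ⌈ n /2⌉ < a → suc b ≤ ⌈ n /2⌉
complement<half {a} {b} {n} a+b≡n half<a =
  ≤-trans (+-cancelʳ-≤ ⌈ n /2⌉ (suc b) ⌊ n /2⌋ (begin
    suc b + ⌈ n /2⌉   ≡⟨ +-comm (suc b) _ ⟩
    ⌈ n /2⌉ + suc b   ≡⟨ +-suc _ b ⟩
    suc ⌈ n /2⌉ + b   ≤⟨ +-monoˡ-≤ b half<a ⟩
    a + b             ≡⟨ a+b≡n ⟩
    n                 ≡⟨ ≡.sym (⌊n/2⌋+⌈n/2⌉≡n n) ⟩
    ⌊ n /2⌋ + ⌈ n /2⌉ ∎))
    (⌊n/2⌋≤⌈n/2⌉ n)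
  where open Data.Nat.Properties.≤-Reasoning

layerColour : ℕ → ℕ
layerColour 2 = 2
layerColour 3 = 1
layerColour _ = 0

layerColour<3 : ∀ d → layerColour d < 3
layerColour<3 0 = s≤s z≤n
layerColour<3 1 = s≤s z≤n
layerColour<3 2 = ≤-refl
layerColour<3 3 = s≤s (s≤s z≤n)
layerColour<3 (suc (suc (suc (suc _)))) = s≤s z≤n

layerColour≡2 : ∀ d → layerColour d ≡ 2 → d ≡ 2
layerColour≡2 2 _ = refl
layerColour≡2 0 ()
layerColour≡2 1 ()
layerColour≡2 3 ()
layerColour≡2 (suc (suc (suc (suc _)))) ()

layerColour≡1 : ∀ d → layerColour d ≡ 1 → d ≡ 3
layerColour≡1 3 _ = refl
layerColour≡1 0 ()
layerColour≡1 1 ()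
layerColour≡1 2 ()
layerColour≡1 (suc (suc (suc (suc _)))) ()

module Labelling {n : ℕ} (G : Graph n) where
  open Walks G

  HasUniqueLabel : (Fin n → ℕ) → List (Fin n) → Set
  HasUniqueLabel ℓ xs = ∃ λ x → x ∈ xs × (∀ {y} → y ∈ xs → ℓ y ≡ ℓ x → y ≡ x)

  -- Single-vertex paths are conflict-free for any colouring, so only paths with an edge matter.
  ConflictFreeLabelling : ℕ → Set
  ConflictFreeLabelling k = ∃ λ (ℓ : Fin n → ℕ) → (∀ v → ℓ v < k) ×
    (∀ {a w b s} → Adj G a w → Walk G w b s → Unique (a ∷ s) → HasUniqueLabel ℓ (a ∷ s))

  conflictFreeLabelling-mono : ∀ {j k} → j ≤ k → ConflictFreeLabelling j → ConflictFreeLabelling k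
  conflictFreeLabelling-mono j≤k (ℓ , bounded , unique) = ℓ , (λ v → ≤-trans (bounded v) j≤k) , unique

  countColor-absent : ∀ {k} (col : Coloring G k) {c} xs → (∀ {y} → y ∈ xs → col y ≢ c) →
                      countColor G col c xs ≡ 0
  countColor-absent col []       _      = refl
  countColor-absent col {c} (a ∷ xs) absent with col a ≟ c
  ... | yes same = ⊥-elim (absent (here refl) same)
  ... | no _     = countColor-absent col xs (absent ∘ there)

  countColor-unique : ∀ {k} (col : Coloring G k) {x} xs → Unique xs → x ∈ xs →
                      (∀ {y} → y ∈ xs → col y ≡ col x → y ≡ x) → countColor G col (col x) xs ≡ 1
  countColor-unique col (a ∷ xs) u (here refl) alone with col a ≟ col a
  ... | no ≢    = ⊥-elim (≢ refl)
  ... | yes _   = cong suc (countColor-absent col xs λ y∈ same →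
                    Unique[x∷xs]⇒x∉xs u (subst (_∈ xs) (alone (there y∈) same) y∈))
  countColor-unique col {x} (a ∷ xs) u@(_ ∷ u′) (there x∈) alone with col a ≟ col x
  ... | yes same = ⊥-elim (Unique[x∷xs]⇒x∉xs u (subst (_∈ xs) (≡.sym (alone (here refl) same)) x∈))
  ... | no _     = countColor-unique col xs u′ x∈ (alone ∘ there)

  labelColouring : ∀ {k} (ℓ : Fin n → ℕ) → (∀ v → ℓ v < k) → Coloring G k
  labelColouring ℓ bounded v = fromℕ< (bounded v)

  uniqueLabel⇒conflictFree : ∀ {k} (ℓ : Fin n → ℕ) (bounded : ∀ v → ℓ v < k) {xs} → Unique xs →
                             HasUniqueLabel ℓ xs → ConflictFree G (labelColouring ℓ bounded) xs
  uniqueLabel⇒conflictFree ℓ bounded {xs} u (x , x∈ , alone) =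
    labelColouring ℓ bounded x , countColor-unique (labelColouring ℓ bounded) xs u x∈ λ {y} y∈ same →
      alone y∈ (≡.trans (≡.sym (toℕ-fromℕ< (bounded y))) (≡.trans (cong toℕ same) (toℕ-fromℕ< (bounded x))))

  conflictFreeLabelling⇒CFVColoring : ∀ {k} → Connected G → ConflictFreeLabelling k → HasCFVColoring G k
  conflictFreeLabelling⇒CFVColoring connected (ℓ , bounded , on-edges) =
    labelColouring ℓ bounded , λ u v →
      let xs , (walk , xs-unique) = connected u v
      in xs , (walk , xs-unique) , uniqueLabel⇒conflictFree ℓ bounded xs-unique (labelled walk xs-unique)
    where
    labelled : ∀ {a b xs} → Walk G a b xs → Unique xs → HasUniqueLabel ℓ xs
    labelled single     _ = _ , here refl , λ { (here refl) _ → refl }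
    labelled (step e p) u = on-edges e p u

  Alternating : (Fin n → Bool) → Set
  Alternating S = ∀ {u v} → Adj G u v → S v ≡ not (S u)

  module _ {S : Fin n → Bool} (alternating : Alternating S) where

    edge-meets-side : ∀ {a w b s} → Adj G a w → Walk G w b s → ∃ λ x → x ∈ a ∷ s × S x ≡ true
    edge-meets-side {a} e p with S a in Sa
    ... | true  = a , here refl , Sa
    ... | false = _ , there (walk-source∈ p) , ≡.trans (alternating e) (cong not Sa)

    sideLabel : Fin n → ℕ
    sideLabel v = if S v then rank S v else count S

    sideLabel-side : ∀ {v} → S v ≡ true → sideLabel v ≡ rank S v
    sideLabel-side Sv rewrite Sv = refl

    side-labelling : ConflictFreeLabelling (suc (count S))
    side-labelling = sideLabel , bounded , λ e p _ → unique (edge-meets-side e p)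
      where
      bounded : ∀ v → sideLabel v < suc (count S)
      bounded v with S v in Sv
      ... | true  = m≤n⇒m≤1+n (rank<count S Sv)
      ... | false = ≤-refl
      unique : ∀ {xs} → ∃ (λ x → x ∈ xs × S x ≡ true) → HasUniqueLabel sideLabel xs
      unique (x , x∈ , Sx) = x , x∈ , λ {y} _ same → alone y (≡.trans same (sideLabel-side Sx))
        where
        alone : ∀ y → sideLabel y ≡ rank S x → y ≡ x
        alone y same with S y in Sy
        ... | true  = rank-injective S Sy Sx same
        ... | false = ⊥-elim (<⇒≢ (rank<count S Sx) (≡.sym same))

    -- r takes over the colour of t, and the other side takes the colour freed by r.
    module Merged {r t : Fin n} (Sr : S r ≡ true) (St : S t ≡ true) (r≢t : r ≢ t) where

      redirect : Fin n → Fin n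
      redirect v = if does (v ≟ r) then t else v

      redirect-cases : ∀ v → (v ≡ r × redirect v ≡ t) ⊎ (v ≢ r × redirect v ≡ v)
      redirect-cases v with v ≟ r
      ... | yes v≡r = inj₁ (v≡r , refl)
      ... | no v≢r  = inj₂ (v≢r , refl)

      redirect≢r : ∀ v → redirect v ≢ r
      redirect≢r v with redirect-cases v
      ... | inj₁ (_ , eq)   = λ to-r → r≢t (≡.trans (≡.sym to-r) eq)
      ... | inj₂ (v≢r , eq) = λ to-r → v≢r (≡.trans (≡.sym eq) to-r)

      S-redirect : ∀ {v} → S v ≡ true → S (redirect v) ≡ true
      S-redirect {v} Sv with redirect-cases v
      ... | inj₁ (_ , eq) = subst (λ u → S u ≡ true) (≡.sym eq) St
      ... | inj₂ (_ , eq) = subst (λ u → S u ≡ true) (≡.sym eq) Sv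

      redirect-collision : ∀ {x y} → redirect y ≡ redirect x → y ≡ x ⊎ (y ≡ r × x ≡ t) ⊎ (y ≡ t × x ≡ r)
      redirect-collision {x} {y} eq with redirect-cases y | redirect-cases x
      ... | inj₁ (y≡r , _)  | inj₁ (x≡r , _)  = inj₁ (≡.trans y≡r (≡.sym x≡r))
      ... | inj₁ (y≡r , ry) | inj₂ (_ , rx)   = inj₂ (inj₁ (y≡r , ≡.trans (≡.sym rx) (≡.trans (≡.sym eq) ry)))
      ... | inj₂ (_ , ry)   | inj₁ (x≡r , rx) = inj₂ (inj₂ (≡.trans (≡.sym ry) (≡.trans eq rx) , x≡r))
      ... | inj₂ (_ , ry)   | inj₂ (_ , rx)   = inj₁ (≡.trans (≡.sym ry) (≡.trans eq rx))

      mergedLabel : Fin n → ℕ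
      mergedLabel v = if S v then rank S (redirect v) else rank S r

      mergedLabel-side : ∀ {v} → S v ≡ true → mergedLabel v ≡ rank S (redirect v)
      mergedLabel-side Sv rewrite Sv = refl

      mergedLabel-collision : ∀ {x y} → S x ≡ true → mergedLabel y ≡ mergedLabel x → redirect y ≡ redirect x
      mergedLabel-collision {x} {y} Sx same with S y in Sy
      ... | true  = rank-injective S (S-redirect Sy) (S-redirect Sx) (≡.trans same (mergedLabel-side Sx))
      ... | false = ⊥-elim (redirect≢r x (≡.sym
                      (rank-injective S Sr (S-redirect Sx) (≡.trans same (mergedLabel-side Sx)))))

      unique-mergedLabel : ∀ {x xs} → x ∈ xs → S x ≡ true → (x ≡ r → t ∉ xs) → (x ≡ t → r ∉ xs) →
                           HasUniqueLabel mergedLabel xs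
      unique-mergedLabel {x} x∈ Sx r-alone t-alone = x , x∈ , λ {y} y∈ same →
        case redirect-collision (mergedLabel-collision Sx same) of λ where
          (inj₁ y≡x)                 → y≡x
          (inj₂ (inj₁ (refl , x≡t))) → ⊥-elim (t-alone x≡t y∈)
          (inj₂ (inj₂ (refl , x≡r))) → ⊥-elim (r-alone x≡r y∈)

      Separated : Set
      Separated = ∀ {a b xs} → Walk G a b xs → Unique xs → r ∈ xs → t ∈ xs →
                  ∃ λ x → x ∈ xs × S x ≡ true × x ≢ r × x ≢ t

      merged-labelling : Separated → ConflictFreeLabelling (count S)
      merged-labelling separated = mergedLabel , bounded , unique
        where
        bounded : ∀ v → mergedLabel v < count S
        bounded v with S v in Sv
        ... | true  = rank<count S (S-redirect Sv)
        ... | false = rank<count S Sr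
        unique : ∀ {a w b s} → Adj G a w → Walk G w b s → Unique (a ∷ s) → HasUniqueLabel mergedLabel (a ∷ s)
        unique {a} {s = s} e p u with any? (r ≟_) (a ∷ s) | any? (t ≟_) (a ∷ s)
        ... | yes r∈ | yes t∈ =
          let x , x∈ , Sx , x≢r , x≢t = separated (step e p) u r∈ t∈
          in unique-mergedLabel x∈ Sx (⊥-elim ∘ x≢r) (⊥-elim ∘ x≢t)
        ... | no r∉  | _      =
          let x , x∈ , Sx = edge-meets-side e p
          in unique-mergedLabel x∈ Sx (λ { refl → ⊥-elim (r∉ x∈) }) (λ _ → r∉)
        ... | yes _  | no t∉  =
          let x , x∈ , Sx = edge-meets-side e p
          in unique-mergedLabel x∈ Sx (λ _ → t∉) (λ { refl → ⊥-elim (t∉ x∈) })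

module Tree {n : ℕ} {G : Graph n} (tree : IsTree G) where
  open Walks G

  treePath : Fin n → Fin n → List (Fin n)
  treePath u v = proj₁ (proj₁ tree u v)

  treePath-walk : ∀ u v → Walk G u v (treePath u v)
  treePath-walk u v = proj₁ (proj₂ (proj₁ tree u v))

  treePath-unique : ∀ u v → Unique (treePath u v)
  treePath-unique u v = proj₂ (proj₂ (proj₁ tree u v))

  treePath-canonical : ∀ {u v s} → Walk G u v s → Unique s → s ≡ treePath u v
  treePath-canonical p u = path-unique (proj₂ tree) p u (treePath-walk _ _) (treePath-unique _ _)

  IsLeaf : Fin n → Set
  IsLeaf r = ∀ {u u′} → Adj G r u → Adj G r u′ → u ≡ u′

  module Rooted (r : Fin n) where

    -- Counts vertices, so depth is distance plus one.
    depth : Fin n → ℕ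
    depth v = length (treePath r v)

    depth≥1 : ∀ v → 1 ≤ depth v
    depth≥1 v = walk-length≥1 (treePath-walk r v)

    depth-root : depth r ≡ 1
    depth-root = cong length (≡.sym (treePath-canonical single ([] ∷ [])))

    depth≡2⇒adjacent : ∀ {v} → depth v ≡ 2 → Adj G r v
    depth≡2⇒adjacent = walk-length≡2 (treePath-walk r _)

    treePath-prefix : ∀ {u v} → v ∈ treePath r u → ∃ λ rest → treePath r u ≡ treePath r v ++ rest
    treePath-prefix {u} v∈ with walk-prefix (treePath-walk r u) v∈
    ... | pre , rest , eq , p = rest , ≡.trans eq (cong (_++ rest) (treePath-canonical p pre-unique))
      where pre-unique = Unique-++⁻ˡ pre (subst Unique eq (treePath-unique r u))

    treePath-∷ʳ : ∀ {u v} → Adj G u v → v ∉ treePath r u → treePath r v ≡ treePath r u ∷ʳ v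
    treePath-∷ʳ {u} e v∉ = ≡.sym (treePath-canonical (walk-∷ʳ (treePath-walk r u) e)
      (++⁺ (treePath-unique r u) ([] ∷ []) λ { (m , here refl) → v∉ m }))

    treePath-mutual-prefix : ∀ {u v xs ys} → treePath r u ≡ treePath r v ++ xs →
                             treePath r v ≡ treePath r u ++ ys → u ≡ v
    treePath-mutual-prefix {u} {v} {xs} {ys} u≡v++xs v≡u++ys =
      walk-target-unique (treePath-walk r u) (subst (Walk G r v) v≡u (treePath-walk r v))
      where
      open ≡.≡-Reasoning
      ys++xs≡[] : ys ++ xs ≡ []
      ys++xs≡[] = ++-identityʳ-unique (treePath r u) (begin
        treePath r u                ≡⟨ u≡v++xs ⟩
        treePath r v ++ xs          ≡⟨ cong (_++ xs) v≡u++ys ⟩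
        (treePath r u ++ ys) ++ xs  ≡⟨ ++-assoc (treePath r u) ys xs ⟩
        treePath r u ++ ys ++ xs    ∎)
      v≡u : treePath r v ≡ treePath r u
      v≡u = begin
        treePath r v        ≡⟨ v≡u++ys ⟩
        treePath r u ++ ys  ≡⟨ cong (treePath r u ++_) (++-conicalˡ ys xs ys++xs≡[]) ⟩
        treePath r u ++ []  ≡⟨ ++-identityʳ (treePath r u) ⟩
        treePath r u        ∎

    treePath-adjacent : ∀ {u v} → Adj G u v →
                        treePath r v ≡ treePath r u ∷ʳ v ⊎ treePath r u ≡ treePath r v ∷ʳ u
    treePath-adjacent {u} {v} e with any? (v ≟_) (treePath r u)
    ... | no v∉ = inj₁ (treePath-∷ʳ e v∉)
    ... | yes v∈ with any? (u ≟_) (treePath r v)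
    ...   | no u∉ = inj₂ (treePath-∷ʳ (sym G e) u∉)
    ...   | yes u∈ = ⊥-elim (irrefl G (subst (Adj G u) (≡.sym u≡v) e))
      where u≡v = treePath-mutual-prefix (proj₂ (treePath-prefix v∈)) (proj₂ (treePath-prefix u∈))

    depth-adjacent : ∀ {u v} → Adj G u v → depth v ≡ suc (depth u) ⊎ depth u ≡ suc (depth v)
    depth-adjacent {u} {v} e with treePath-adjacent e
    ... | inj₁ eq = inj₁ (≡.trans (cong length eq) (length-∷ʳ (treePath r u)))
    ... | inj₂ eq = inj₂ (≡.trans (cong length eq) (length-∷ʳ (treePath r v)))

    depth-step≤ : ∀ {u v} → Adj G u v → depth v ≤ suc (depth u)
    depth-step≤ e with depth-adjacent e
    ... | inj₁ eq = ≤-reflexive eq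
    ... | inj₂ eq = ≤-trans (n≤1+n _) (≤-trans (≤-reflexive (≡.sym eq)) (n≤1+n _))

    treePath-child : ∀ {u v} → Adj G u v → depth v ≡ suc (depth u) → treePath r v ≡ treePath r u ∷ʳ v
    treePath-child {u} {v} e deeper with treePath-adjacent e
    ... | inj₁ eq = eq
    ... | inj₂ eq = ⊥-elim (1+n≰n (≤-trans (n≤1+n _) (≤-reflexive (≡.sym twice-deeper))))
      where
      twice-deeper : depth v ≡ suc (suc (depth v))
      twice-deeper = ≡.trans deeper (cong suc (≡.trans (cong length eq) (length-∷ʳ (treePath r v))))

    parent-unique : ∀ {u u′ v} → Adj G u v → Adj G u′ v →
                    depth v ≡ suc (depth u) → depth v ≡ suc (depth u′) → u ≡ u′
    parent-unique {u} {u′} {v} e e′ d d′ =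
      walk-target-unique (treePath-walk r u) (subst (Walk G r u′) (≡.sym same) (treePath-walk r u′))
      where same = ∷ʳ-injectiveˡ (treePath r u) (treePath r u′)
                     (≡.trans (≡.sym (treePath-child e d)) (treePath-child e′ d′))

    depth-intermediate : ∀ {a b s y z m} → Walk G a b s → y ∈ s → z ∈ s → depth y ≤ m → m ≤ depth z →
                         ∃ λ x → x ∈ s × depth x ≡ m
    depth-intermediate {a} single (here refl) (here refl) y≤m m≤z = a , here refl , ≤-antisym y≤m m≤z
    depth-intermediate {a} {m = m} (step e p) y∈ z∈ y≤m m≤z with <-cmp (depth a) m | y∈ | z∈
    ... | tri≈ _ a≡m _ | _ | _ = a , here refl , a≡m
    ... | tri< a<m _ _ | _ | here refl = ⊥-elim (<⇒≱ a<m m≤z)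
    ... | tri< a<m _ _ | _ | there z∈s =
      map₂ (map₁ there) (depth-intermediate p (walk-source∈ p) z∈s (≤-trans (depth-step≤ e) a<m) m≤z)
    ... | tri> _ _ m<a | here refl | _ = ⊥-elim (<⇒≱ m<a y≤m)
    ... | tri> _ _ m<a | there y∈s | _ =
      map₂ (map₁ there)
        (depth-intermediate p y∈s (walk-source∈ p) y≤m (≤-pred (≤-trans m<a (depth-step≤ (sym G e)))))

    -- Once a path steps down from u to a child w, it can only climb back through u.
    deeper-after-child : ∀ {u w b s} → Adj G u w → depth w ≡ suc (depth u) → Walk G w b s → Unique (u ∷ s) →
                         All (λ y → depth w ≤ depth y) s
    deeper-after-child _ _ single _ = ≤-refl ∷ []
    deeper-after-child e deeper (step e′ p) u∷s@(_ ∷ s-unique) with depth-adjacent e′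
    ... | inj₁ deeper′ =
      ≤-refl ∷ All.map (≤-trans (≤-trans (n≤1+n _) (≤-reflexive (≡.sym deeper′))))
                       (deeper-after-child e′ deeper′ p s-unique)
    ... | inj₂ shallower =
      ⊥-elim (Unique[x∷xs]⇒x∉xs u∷s
        (there (subst (_∈ _) (parent-unique (sym G e′) e shallower deeper) (walk-source∈ p))))

    path-below-start : ∀ {w b s} → Walk G w b s → Unique s →
                       (∀ {u} → Adj G u w → depth w ≡ suc (depth u) → u ∉ s) →
                       ∀ {y} → y ∈ s → y ≡ w ⊎ depth w < depth y
    path-below-start single     _ _ (here refl) = inj₁ refl
    path-below-start (step _ _) _ _ (here refl) = inj₁ refl
    path-below-start (step e p) u no-parent (there y∈) with depth-adjacent e
    ... | inj₁ deeper = inj₂ (subst (_≤ _) deeper (All.lookup (deeper-after-child e deeper p u) y∈))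
    ... | inj₂ shallower = ⊥-elim (no-parent (sym G e) shallower (there (walk-source∈ p)))

  farthest-is-leaf : Fin n → ∃ IsLeaf
  farthest-is-leaf v = r , leaf
    where
    open Rooted v
    r = argmax depth v (allFin n)
    farthest : ∀ u → depth u ≤ depth r
    farthest u = All.lookup (f[xs]≤f[argmax] v (allFin n)) (∈-allFin u)
    leaf : IsLeaf r
    leaf {u} {u′} e e′ with depth-adjacent e | depth-adjacent e′
    ... | inj₁ deeper | _            = ⊥-elim (1+n≰n (subst (_≤ _) deeper (farthest u)))
    ... | inj₂ _      | inj₁ deeper′ = ⊥-elim (1+n≰n (subst (_≤ _) deeper′ (farthest u′)))
    ... | inj₂ d      | inj₂ d′      = parent-unique (sym G e) (sym G e′) d d′

module TreeColouring {n : ℕ} {G : Graph n} (tree : IsTree G) where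
  open Walks G
  open Tree tree
  open Labelling G

  module _ (r : Fin n) where
    open Rooted r

    oddDepth : Fin n → Bool
    oddDepth = odd ∘ depth

    oddDepth-alternating : Alternating oddDepth
    oddDepth-alternating e with depth-adjacent e
    ... | inj₁ deeper    rewrite deeper    = refl
    ... | inj₂ shallower rewrite shallower = ≡.sym (not-involutive _)

    oddDepth-root : oddDepth r ≡ true
    oddDepth-root rewrite depth-root = refl

    module _ {t : Fin n} (depth-t : depth t ≡ 5) where

      r≢t : r ≢ t
      r≢t refl = case ≡.trans (≡.sym depth-t) depth-root of λ ()

      open Merged oddDepth-alternating oddDepth-root (cong odd depth-t) r≢t

      depth-five-separated : Separated
      depth-five-separated p _ r∈ t∈
        with depth-intermediate p r∈ t∈ (subst (_≤ 3) (≡.sym depth-root) (s≤s z≤n))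
                                        (subst (3 ≤_) (≡.sym depth-t) (s≤s (s≤s (s≤s z≤n))))
      ... | x , x∈ , depth-x =
        x , x∈ , cong odd depth-x ,
        (λ { refl → case ≡.trans (≡.sym depth-x) depth-root of λ () }) ,
        (λ { refl → case ≡.trans (≡.sym depth-x) depth-t of λ () })

      depth-five-labelling : ConflictFreeLabelling (count oddDepth)
      depth-five-labelling = merged-labelling depth-five-separated

    third-layer-unique : ∀ {x b xs} → Walk G x b xs → Unique xs → depth x ≡ 3 →
                         (∀ {y} → y ∈ xs → depth y ≢ 2) → ∀ {y} → y ∈ xs → depth y ≡ 3 → y ≡ x
    third-layer-unique p u depth-x no-layer-2 y∈ depth-y
      with path-below-start p u (λ _ deeper v∈ → no-layer-2 v∈ (suc-injective (≡.trans (≡.sym deeper) depth-x))) y∈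
    ... | inj₁ y≡x = y≡x
    ... | inj₂ x<y = ⊥-elim (<⇒≢ x<y (≡.trans depth-x (≡.sym depth-y)))

    shallow-path-third-layer : (∀ v → depth v ≤ 4) → ∀ {a w b s} → Adj G a w → Walk G w b s → Unique (a ∷ s) →
                               (∀ {y} → y ∈ a ∷ s → depth y ≢ 2) →
                               ∃ λ x → x ∈ a ∷ s × depth x ≡ 3 × (∀ {y} → y ∈ a ∷ s → depth y ≡ 3 → y ≡ x)
    shallow-path-third-layer shallow {a} e p u@(_ ∷ s-unique) no-layer-2 with depth a in depth-a
    ... | 0 = ⊥-elim (case subst (1 ≤_) depth-a (depth≥1 a) of λ ())
    ... | 1 = case depth-adjacent e of λ where
      (inj₁ deeper)    → ⊥-elim (no-layer-2 (there (walk-source∈ p)) (≡.trans deeper (cong suc depth-a)))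
      (inj₂ shallower) → ⊥-elim (case subst (1 ≤_) (suc-injective (≡.trans (≡.sym shallower) depth-a)) (depth≥1 _)
                                 of λ ())
    ... | 2 = ⊥-elim (no-layer-2 (here refl) depth-a)
    ... | 3 = a , here refl , depth-a , third-layer-unique (step e p) u depth-a no-layer-2
    ... | 4 = case depth-adjacent e of λ where
      (inj₁ deeper)    → ⊥-elim (<⇒≱ ≤-refl (subst (_≤ 4) (≡.trans deeper (cong suc depth-a)) (shallow _)))
      (inj₂ shallower) →
        let depth-w = suc-injective (≡.trans (≡.sym shallower) depth-a)
        in _ , there (walk-source∈ p) , depth-w , λ where
             (here refl) depth-y → case ≡.trans (≡.sym depth-a) depth-y of λ ()
             (there y∈)          → third-layer-unique p s-unique depth-w (no-layer-2 ∘ there) y∈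
    ... | suc (suc (suc (suc (suc _)))) =
      ⊥-elim (<⇒≱ (s≤s (s≤s (s≤s (s≤s (s≤s z≤n))))) (subst (_≤ 4) depth-a (shallow a)))

    -- Depth 2 holds only the neighbour of the leaf r, so colour 2 is never repeated.
    shallow-labelling : IsLeaf r → (∀ v → depth v ≤ 4) → ConflictFreeLabelling 3
    shallow-labelling leaf shallow = layerColour ∘ depth , layerColour<3 ∘ depth , unique
      where
      unique : ∀ {a w b s} → Adj G a w → Walk G w b s → Unique (a ∷ s) →
               HasUniqueLabel (layerColour ∘ depth) (a ∷ s)
      unique {a} {s = s} e p u with any? (λ y → depth y ℕ.≟ 2) (a ∷ s)
      ... | yes layer-2 =
        let x , x∈ , depth-x = find layer-2
        in x , x∈ , λ {y} _ same →
             leaf (depth≡2⇒adjacent (layerColour≡2 (depth y) (≡.trans same (cong layerColour depth-x))))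
                  (depth≡2⇒adjacent depth-x)
      ... | no no-layer-2 =
        let x , x∈ , depth-x , alone = shallow-path-third-layer shallow e p u (λ y∈ d2 → no-layer-2 (lose y∈ d2))
        in x , x∈ , λ {y} y∈ same → alone y∈ (layerColour≡1 (depth y) (≡.trans same (cong layerColour depth-x)))

    no-depth-five⇒shallow : (∀ v → depth v ≢ 5) → ∀ v → depth v ≤ 4
    no-depth-five⇒shallow no-five v with depth v ≤? 4
    ... | yes shallow = shallow
    ... | no deep =
      let path = treePath-walk r v
          x , _ , depth-x = depth-intermediate path (walk-source∈ path) (walk-target∈ path)
                              (subst (_≤ 5) (≡.sym depth-root) (s≤s z≤n)) (≰⇒> deep)
      in ⊥-elim (no-five x depth-x)

    leaf-rooted-labelling : IsLeaf r → 5 ≤ n → ConflictFreeLabelling ⌈ n /2⌉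
    leaf-rooted-labelling leaf 5≤n with count oddDepth ≤? ⌈ n /2⌉ | Fin-any? (λ v → depth v ℕ.≟ 5)
    ... | yes few-odd | yes (t , depth-t) = conflictFreeLabelling-mono few-odd (depth-five-labelling depth-t)
    ... | yes _       | no no-five        =
      conflictFreeLabelling-mono (⌈n/2⌉-mono 5≤n)
        (shallow-labelling leaf (no-depth-five⇒shallow λ v d → no-five (v , d)))
    ... | no many-odd | _                 =
      conflictFreeLabelling-mono (complement<half (count+count-not oddDepth) (≰⇒> many-odd))
        (side-labelling λ e → cong not (oddDepth-alternating e))

  tree-labelling : Fin n → 5 ≤ n → ConflictFreeLabelling ⌈ n /2⌉
  tree-labelling v 5≤n = let r , leaf = farthest-is-leaf v in leaf-rooted-labelling r leaf 5≤n

least-witness : {P : ℕ → Set} → (∀ j → Dec (P j)) → ∀ {j} → P j →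
                ∃ λ k → (P k × (∀ i → P i → k ≤ i)) × k ≤ j
least-witness {P} P? {j} = <-rec (λ j → P j → LeastBelow j) least j
  where
  LeastBelow : ℕ → Set
  LeastBelow j = ∃ λ k → (P k × (∀ i → P i → k ≤ i)) × k ≤ j
  least : ∀ j → (∀ {i} → i < j → P i → LeastBelow i) → P j → LeastBelow j
  least j smaller Pj with anyUpTo? P? j
  ... | no none = j , (Pj , λ i Pi → ≮⇒≥ λ i<j → none (i , i<j , Pi)) , ≤-refl
  ... | yes (i , i<j , Pi) = let k , minimal , k≤i = smaller i<j Pi in k , minimal , ≤-trans k≤i (<⇒≤ i<j)

-- Without function extensionality Q must be assumed to respect pointwise equality.
∃-function? : ∀ m {k} (Q : (Fin m → Fin k) → Set) → (∀ {f g} → f ≗ g → Q f → Q g) →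
              (∀ f → Dec (Q f)) → Dec (∃ Q)
∃-function? zero Q resp Q? with Q? (λ ())
... | yes q  = yes (_ , q)
... | no ¬q = no λ (f , qf) → ¬q (resp (λ ()) qf)
∃-function? (suc m) Q resp Q?
  with Fin-any? (λ a → ∃-function? m (Q ∘ (a Vector.∷_))
                         (λ f≗g → resp λ { Fin.zero → refl ; (Fin.suc i) → f≗g i }) (Q? ∘ (a Vector.∷_)))
... | yes (a , g , q) = yes (a Vector.∷ g , q)
... | no none =
  no λ (f , qf) → none (Vector.head f , Vector.tail f , resp (λ { Fin.zero → refl ; (Fin.suc i) → refl }) qf)

module TreeVcfc {n : ℕ} {G : Graph n} (tree : IsTree G) where
  open Tree tree

  countColor-cong : ∀ {k} {f g : Coloring G k} → f ≗ g → ∀ c xs → countColor G f c xs ≡ countColor G g c xs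
  countColor-cong f≗g c []       = refl
  countColor-cong {f = f} {g} f≗g c (a ∷ xs) rewrite f≗g a with g a Fin.≟ c
  ... | yes _ = cong suc (countColor-cong f≗g c xs)
  ... | no _  = countColor-cong f≗g c xs

  TreePathsConflictFree : ∀ {k} → Coloring G k → Set
  TreePathsConflictFree col = ∀ u v → ConflictFree G col (treePath u v)

  treePathsConflictFree? : ∀ {k} (col : Coloring G k) → Dec (TreePathsConflictFree col)
  treePathsConflictFree? col = Fin-all? λ u → Fin-all? λ v → Fin-any? λ c → countColor G col c (treePath u v) ℕ.≟ 1

  treePathsConflictFree⇒CFVConnected : ∀ {k} {col : Coloring G k} → TreePathsConflictFree col → CFVConnected G col
  treePathsConflictFree⇒CFVConnected cf u v = treePath u v , (treePath-walk u v , treePath-unique u v) , cf u v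

  CFVConnected⇒treePathsConflictFree : ∀ {k} {col : Coloring G k} → CFVConnected G col → TreePathsConflictFree col
  CFVConnected⇒treePathsConflictFree {col = col} cfc u v =
    let xs , (walk , unique) , cf = cfc u v in subst (ConflictFree G col) (treePath-canonical walk unique) cf

  hasCFVColoring? : ∀ k → Dec (HasCFVColoring G k)
  hasCFVColoring? k =
    map′ (λ (col , cf) → col , treePathsConflictFree⇒CFVConnected cf)
         (λ (col , cfc) → col , CFVConnected⇒treePathsConflictFree cfc)
         (∃-function? n TreePathsConflictFree
            (λ f≗g cf u v → let c , one = cf u v in c , ≡.trans (≡.sym (countColor-cong f≗g c (treePath u v))) one)
            treePathsConflictFree?)

  vcfc-at-most : ∀ {k} → HasCFVColoring G k → ∃ λ j → IsVcfc G j × j ≤ k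
  vcfc-at-most = least-witness hasCFVColoring?

module PathGraph (m : ℕ) where
  open Walks (pathGraph m)

  climbing-path-end : ∀ {u w b s} → Walk (pathGraph m) w b s → Unique (u ∷ s) → toℕ w ≡ suc (toℕ u) →
             toℕ b ≡ length s + toℕ u
  climbing-path-end single _ up = up
  climbing-path-end {u} (step {xs = s} (inj₁ up′) p) (_ ∷ s-unique) up =
    ≡.trans (climbing-path-end p s-unique up′) (≡.trans (cong (length s +_) up) (+-suc (length s) (toℕ u)))
  climbing-path-end (step (inj₂ down) p) u∷s up =
    ⊥-elim (Unique[x∷xs]⇒x∉xs u∷s (there (subst (_∈ _) (toℕ-injective (suc-injective (≡.trans (≡.sym down) up)))
                                                     (walk-source∈ p))))

  descending-path-end : ∀ {u w b s} → Walk (pathGraph m) w b s → Unique (u ∷ s) → toℕ u ≡ suc (toℕ w) →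
               toℕ u ≡ length s + toℕ b
  descending-path-end single _ down = down
  descending-path-end (step (inj₂ down′) p) (_ ∷ s-unique) down =
    ≡.trans down (cong suc (descending-path-end p s-unique down′))
  descending-path-end (step (inj₁ up) p) u∷s down =
    ⊥-elim (Unique[x∷xs]⇒x∉xs u∷s
      (there (subst (_∈ _) (toℕ-injective (≡.trans up (≡.sym down))) (walk-source∈ p))))

  far-apart-not-adjacent : ∀ {x y} k → toℕ y ≡ k + toℕ x → 2 ≤ k → ¬ Adj (pathGraph m) y x
  far-apart-not-adjacent {x} k y≡ _ (inj₁ x≡1+y) = <⇒≢ (s≤s (m≤n+m (toℕ x) k)) (≡.trans x≡1+y (cong suc y≡))
  far-apart-not-adjacent {x} k y≡ 2≤k (inj₂ y≡1+x) with +-cancelʳ-≡ (toℕ x) k 1 (≡.trans (≡.sym y≡) y≡1+x)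
  far-apart-not-adjacent _ _ (s≤s ()) _ | refl

  acyclic : Acyclic (pathGraph m)
  acyclic _ (_ , _ , (single , _) , _ , s≤s ())
  acyclic _ (_ , _ , (step {xs = s} (inj₁ up) p , u) , back , s≤s long) =
    far-apart-not-adjacent (length s) (climbing-path-end p u up) long back
  acyclic _ (_ , _ , (step {xs = s} (inj₂ down) p , u) , back , s≤s long) =
    far-apart-not-adjacent (length s) (descending-path-end p u down) long (sym (pathGraph m) back)

  ascending-path : ∀ k {u v : Fin m} → toℕ u + k ≡ toℕ v →
                   ∃ λ xs → IsPath (pathGraph m) u v xs × All (λ x → toℕ u ≤ toℕ x) xs
  ascending-path zero {u} u+0≡v with toℕ-injective (≡.trans (≡.sym (+-identityʳ (toℕ u))) u+0≡v)
  ... | refl = _ , (single , [] ∷ []) , ≤-refl ∷ []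
  ascending-path (suc k) {u} {v} u+k≡v =
    let xs , (p , unique) , above = ascending-path k {fromℕ< next<m} {v} next+k≡v
        above′ = subst (λ a → All (λ x → a ≤ toℕ x) xs) (toℕ-fromℕ< next<m) above
    in u ∷ xs , (step (inj₁ (toℕ-fromℕ< next<m)) p , All.map (λ le → λ { refl → 1+n≰n le }) above′ ∷ unique) ,
       ≤-refl ∷ All.map (≤-trans (n≤1+n _)) above′
    where
    next≤v : suc (toℕ u) ≤ toℕ v
    next≤v = subst (suc (toℕ u) ≤_) (≡.trans (≡.sym (+-suc (toℕ u) k)) u+k≡v) (s≤s (m≤m+n (toℕ u) k))
    next<m : suc (toℕ u) < m
    next<m = ≤-trans (s≤s next≤v) (toℕ<n v)
    next+k≡v : toℕ (fromℕ< next<m) + k ≡ toℕ v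
    next+k≡v = ≡.trans (cong (_+ k) (toℕ-fromℕ< next<m)) (≡.trans (≡.sym (+-suc (toℕ u) k)) u+k≡v)

  connected : Connected (pathGraph m)
  connected u v with ≤-total (toℕ u) (toℕ v)
  ... | inj₁ u≤v = let xs , path , _ = ascending-path (toℕ v ∸ toℕ u) (m+[n∸m]≡n u≤v) in xs , path
  ... | inj₂ v≤u =
    let xs , (p , unique) , _ = ascending-path (toℕ u ∸ toℕ v) (m+[n∸m]≡n v≤u)
    in reverse xs , walk-reverse p , Unique-reverse unique

pathGraph-isTree : ∀ m → IsTree (pathGraph m)
pathGraph-isTree m = PathGraph.connected m , PathGraph.acyclic m

tree-vcfc≤half : (n : ℕ) → n ≥ 5 → (T : Graph n) → IsTree T → ∃ λ k → IsVcfc T k × k ≤ ⌈ n /2⌉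
tree-vcfc≤half (suc _) 5≤n T tree =
  TreeVcfc.vcfc-at-most tree
    (Labelling.conflictFreeLabelling⇒CFVColoring T (proj₁ tree) (TreeColouring.tree-labelling tree Fin.zero 5≤n))

module P₅ = TreeVcfc (pathGraph-isTree 5)

P₅-colouring : Coloring (pathGraph 5) 3
P₅-colouring = lookup (# 0 ∷ # 1 ∷ # 0 ∷ # 2 ∷ # 0 ∷ [])

P₅-colouring-CFVConnected : CFVConnected (pathGraph 5) P₅-colouring
P₅-colouring-CFVConnected =
  P₅.treePathsConflictFree⇒CFVConnected (toWitness {a? = P₅.treePathsConflictFree? P₅-colouring} _)

P₅-needs-3-colours : ∀ j → HasCFVColoring (pathGraph 5) j → 3 ≤ j
P₅-needs-3-colours 0                   = ⊥-elim ∘ toWitnessFalse {a? = P₅.hasCFVColoring? 0} _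
P₅-needs-3-colours 1                   = ⊥-elim ∘ toWitnessFalse {a? = P₅.hasCFVColoring? 1} _
P₅-needs-3-colours 2                   = ⊥-elim ∘ toWitnessFalse {a? = P₅.hasCFVColoring? 2} _
P₅-needs-3-colours (suc (suc (suc _))) _ = s≤s (s≤s (s≤s z≤n))

vcfc-P₅ : IsVcfc (pathGraph 5) 3
vcfc-P₅ = (P₅-colouring , P₅-colouring-CFVConnected) , P₅-needs-3-colours

proposition2 : ((n : ℕ) → n ≥ 5 → (T : Graph n) → IsTree T →
    ∃ λ k → IsVcfc T k × k ≤ ⌈ n /2⌉)
    × IsVcfc (pathGraph 5) 3
proposition2 = tree-vcfc≤half , vcfc-P₅
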